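{- Let $a$ and $b$ be relatively prime positive integers and let $k \ge 0$ be an integer. Let $S_k(a,b)$ be the set of all nonnegative integers $j$ having more than $k$ representations in the form $j = ma + nb$ with $m, n \in \mathbb{Z}_{\ge 0}$. Then, as formal power series in $z$, \[ \sum_{ j \in S_k (a,b) } z^j \ = \ \frac{ z^{ abk } (1 - z^{ ab }) }{ (1-z^a) (1-z^b) } \, . \] Consequently, for $k \ge 1$, letting $R_k(a,b)$ be the set of all nonnegative integers $j$ having exactly $k$ representations $j = ma+nb$ with $m,n \in \mathbb{Z}_{\ge 0}$, we have \[ \sum_{ j \in R_k (a,b) } z^j \ = \ \frac{ z^{ ab(k-1) } (1 - z^{ ab })^2 }{ (1-z^a) (1-z^b) } \, . \]
   Context: The number of representations of a nonnegative integer $j$ is the number of pairs $(m,n) \in \mathbb{Z}_{\ge 0}^2$ with $ma + nb = j$. -}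

module Defs where

open import Data.Nat as ℕ using (ℕ; zero; suc; _∸_; _<_; _≟_; _<?_)
open import Data.Nat.Divisibility using (_∣?_)
open import Data.Integer as ℤ using (ℤ; 0ℤ; 1ℤ)
open import Data.Bool using (Bool; if_then_else_)
open import Relation.Nullary.Decidable using (⌊_⌋)
open import Relation.Binary.PropositionalEquality using (_≡_)

FPS : Set
FPS = ℕ → ℤ

sumℕ : (ℕ → ℕ) → ℕ → ℕ
sumℕ f zero    = f zero
sumℕ f (suc n) = sumℕ f n ℕ.+ f (suc n)

sumℤ : (ℕ → ℤ) → ℕ → ℤ
sumℤ f zero    = f zero
sumℤ f (suc n) = sumℤ f n ℤ.+ f (suc n)

_⊕_ : FPS → FPS → FPS
(f ⊕ g) n = f n ℤ.+ g n

_⊖_ : FPS → FPS → FPS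
(f ⊖ g) n = f n ℤ.- g n

_⊛_ : FPS → FPS → FPS
(f ⊛ g) n = sumℤ (λ i → f i ℤ.* g (n ∸ i)) n

infixl 6 _⊕_ _⊖_
infixl 7 _⊛_

mono : ℕ → FPS
mono e n = if ⌊ n ≟ e ⌋ then 1ℤ else 0ℤ

one : FPS
one = mono 0

-- 1/(1 - z^a) = Σ_{i≥0} z^{a i}  (a > 0): coefficient of z^n is 1 iff a ∣ n
geom : ℕ → FPS
geom a n = if ⌊ a ∣? n ⌋ then 1ℤ else 0ℤ

-- Number of pairs (m , n) ∈ ℕ² with m a + n b = j.  For a , b ≥ 1 any such
-- pair has m ≤ j and n ≤ j, so enumerating m , n ∈ {0..j} counts all of them.
reps : ℕ → ℕ → ℕ → ℕ
reps a b j = sumℕ (λ m → sumℕ (λ n → if ⌊ m ℕ.* a ℕ.+ n ℕ.* b ≟ j ⌋ then 1 else 0) j) j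

Sseries : ℕ → ℕ → ℕ → FPS
Sseries a b k j = if ⌊ k <? reps a b j ⌋ then 1ℤ else 0ℤ

Rseries : ℕ → ℕ → ℕ → FPS
Rseries a b k j = if ⌊ reps a b j ≟ k ⌋ then 1ℤ else 0ℤ

_≈ₛ_ : FPS → FPS → Set
f ≈ₛ g = ∀ n → f n ≡ g n
infix 4 _≈ₛ_

-- Write r(j) for the number of representations, N = ab and G = 1/((1-z^a)(1-z^b)).
--  * Counting (module Representations).  Separating the representations with m = 0 gives
--    r(j) = [b ∣ j] for j < a and r(a + n) = [b ∣ a + n] + r(n).  Unrolling, r(ρ + s·a) for ρ < a
--    counts the t ≤ s with b ∣ ρ + t·a; by coprimality every block of b consecutive t contains
--    exactly one such t (module Residues), so r(N + n) = r(n) + 1 and r(n) ≤ 1 for n < N.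
--  * Series.  G - z^a G = 1/(1-z^b), so the coefficients of G obey the same recursion: G_j = r(j).
--  * Level sets (module LevelSets).  For any ρ with ρ(N + n) = ρ(n) + 1 and ρ ≤ 1 below N,
--    [ρ(n) > k] is the coefficient of z^n in (z^{kN} - z^{(k+1)N}) Σ_j ρ(j) z^j.
-- With a little algebra of the Cauchy product with monomials, this is the formula for S_k;
-- the formula for R_k follows from R_k = S_{k-1} \ S_k.
module Submission where

open import Defs
open import Data.Bool using (if_then_else_)
open import Data.Empty using (⊥; ⊥-elim)
open import Data.Integer as ℤ using (ℤ; 0ℤ; 1ℤ; +_)
import Data.Integer.Properties as ℤ
open import Data.Integer.Tactic.RingSolver using (solve-∀)
import Data.Nat as ℕ
open import Data.Nat
  using (ℕ; zero; suc; _+_; _*_; _∸_; _<_; _≤_; _≤′_; ≤′-refl; ≤′-step; z≤n; s≤s; _≟_; _<?_; >-nonZero)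
open import Data.Nat.Properties
  using ( ≤-refl; ≤-trans; ≤-antisym; ≤-reflexive; ≤-pred; ≤⇒≤′; ≤′⇒≤; <-irrefl; <-trans; <-cmp
        ; <-≤-trans; ≤-<-trans; <⇒≤; <⇒≱; ≮⇒≥; ≤∧≢⇒<; n<1+n; m≤n⇒m≤1+n; m≤m+n; m≤n+m; m<n+m
        ; m≤m*n; m∸n≤m; m<n⇒0<n∸m; m+[n∸m]≡n; [m+n]∸[m+o]≡n∸o
        ; +-suc; +-assoc; +-comm; +-identityʳ; +-cancelˡ-≡; *-suc; *-comm; *-cancelʳ-≡ )
open import Data.Nat.Coprimality using (Coprime; coprime-Bézout; coprime-divisor)
import Data.Nat.Coprimality as Coprimality
open import Data.Nat.Divisibility
  using (_∣_; divides; _∣?_; _∣0; ∣-refl; ∣⇒≤; ∣n⇒∣m*n; n∣m*n; m∣m*n; ∣m+n∣m⇒∣n; ∣m∣n⇒∣m+n)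
open import Data.Nat.DivMod using (_/_; _%_; m<n*o⇒m/o<n; m%n<n; m≡m%n+[m/n]*n)
open import Data.Nat.GCD using (module Bézout)
open import Data.Nat.Induction using (<-rec)
open import Data.Nat.Tactic.RingSolver renaming (solve-∀ to ℕ-solve-∀)
open import Data.Product using (∃; _×_; _,_)
open import Function.Bundles using (mk⇔)
open import Relation.Binary.Definitions using (tri<; tri≈; tri>)
open import Relation.Binary.PropositionalEquality
  using (_≡_; refl; sym; trans; cong; cong₂; subst; module ≡-Reasoning)
open import Relation.Nullary using (Dec; yes; no; ¬_; contradiction)
open import Relation.Nullary.Decidable using (⌊_⌋; isYes≗does; does-⇔)

module FiniteSums {A : Set} (_⊹_ : A → A → A) (ε : A) (ε-identityʳ : ∀ x → x ⊹ ε ≡ x)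
                  (Σ : (ℕ → A) → ℕ → A) (Σ-suc : ∀ f n → Σ f (suc n) ≡ Σ f n ⊹ f (suc n))
                  (Σ-zero : ∀ f → Σ f zero ≡ f zero) where

  Σ-cong : ∀ {f g} n → (∀ i → i ≤ n → f i ≡ g i) → Σ f n ≡ Σ g n
  Σ-cong {f} {g} zero h = trans (Σ-zero f) (trans (h 0 z≤n) (sym (Σ-zero g)))
  Σ-cong {f} {g} (suc n) h =
    trans (Σ-suc f n) (trans (cong₂ _⊹_ (Σ-cong n (λ i p → h i (m≤n⇒m≤1+n p))) (h (suc n) ≤-refl))
                             (sym (Σ-suc g n)))

  Σ-truncate : ∀ {f j M} → j ≤ M → (∀ i → j < i → f i ≡ ε) → Σ f M ≡ Σ f j
  Σ-truncate {f} {j} j≤M vanish = go (≤⇒≤′ j≤M)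
    where
    go : ∀ {M} → j ≤′ M → Σ f M ≡ Σ f j
    go ≤′-refl = refl
    go {suc M} (≤′-step p) = begin
      Σ f (suc M)       ≡⟨ Σ-suc f M ⟩
      Σ f M ⊹ f (suc M) ≡⟨ cong₂ _⊹_ (go p) (vanish (suc M) (s≤s (≤′⇒≤ p))) ⟩
      Σ f j ⊹ ε         ≡⟨ ε-identityʳ _ ⟩
      Σ f j             ∎
      where open ≡-Reasoning

  Σ-vanish : ∀ {f} n → (∀ i → i ≤ n → f i ≡ ε) → Σ f n ≡ ε
  Σ-vanish {f} zero h = trans (Σ-zero f) (h 0 z≤n)
  Σ-vanish {f} (suc n) h =
    trans (Σ-suc f n) (trans (cong₂ _⊹_ (Σ-vanish n (λ i p → h i (m≤n⇒m≤1+n p))) (h (suc n) ≤-refl))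
                             (ε-identityʳ ε))

module ΣNat = FiniteSums _+_ 0 +-identityʳ sumℕ (λ _ _ → refl) (λ _ → refl)
module ΣInt = FiniteSums ℤ._+_ 0ℤ ℤ.+-identityʳ sumℤ (λ _ _ → refl) (λ _ → refl)
open ΣNat using () renaming (Σ-cong to sumℕ-cong; Σ-truncate to sumℕ-truncate; Σ-vanish to sumℕ-vanish)
open ΣInt using () renaming (Σ-cong to sumℤ-cong; Σ-truncate to sumℤ-truncate; Σ-vanish to sumℤ-vanish)

sumℕ-split : ∀ f p q → sumℕ f (p + suc q) ≡ sumℕ f p + sumℕ (λ i → f (suc p + i)) q
sumℕ-split f p zero = begin
  sumℕ f (p + 1)            ≡⟨ cong (sumℕ f) (+-comm p 1) ⟩
  sumℕ f p + f (suc p)      ≡⟨ cong (λ i → sumℕ f p + f i) (sym (+-identityʳ (suc p))) ⟩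
  sumℕ f p + f (suc p + 0)  ∎
  where open ≡-Reasoning
sumℕ-split f p (suc q) = begin
  sumℕ f (p + suc (suc q))                              ≡⟨ cong (sumℕ f) (+-suc p (suc q)) ⟩
  sumℕ f (p + suc q) + f (suc p + suc q)                ≡⟨ cong (_+ f (suc p + suc q)) (sumℕ-split f p q) ⟩
  sumℕ f p + sumℕ g q + g (suc q)                       ≡⟨ +-assoc (sumℕ f p) (sumℕ g q) (g (suc q)) ⟩
  sumℕ f p + sumℕ g (suc q)                             ∎
  where
  open ≡-Reasoning
  g : ℕ → ℕ
  g i = f (suc p + i)

sumℕ-mono : ∀ f {s t} → s ≤ t → sumℕ f s ≤ sumℕ f t
sumℕ-mono f {s} s≤t = go (≤⇒≤′ s≤t)
  where
  go : ∀ {t} → s ≤′ t → sumℕ f s ≤ sumℕ f t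
  go ≤′-refl = ≤-refl
  go (≤′-step p) = ≤-trans (go p) (m≤m+n _ _)

⌊⌋-iff : {A B : Set} (dA : Dec A) (dB : Dec B) → (A → B) → (B → A) → ⌊ dA ⌋ ≡ ⌊ dB ⌋
⌊⌋-iff dA dB f g = trans (isYes≗does dA) (trans (does-⇔ (mk⇔ f g) dA dB) (sym (isYes≗does dB)))

ind : {A : Set} → Dec A → ℕ
ind d = if ⌊ d ⌋ then 1 else 0

χ : {A : Set} → Dec A → ℤ
χ d = if ⌊ d ⌋ then 1ℤ else 0ℤ

ind-yes : {A : Set} (d : Dec A) → A → ind d ≡ 1
ind-yes (yes _) _ = refl
ind-yes (no ¬a) a = contradiction a ¬a

ind-no : {A : Set} (d : Dec A) → ¬ A → ind d ≡ 0
ind-no (yes a) ¬a = contradiction a ¬a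
ind-no (no _) _ = refl

ind-iff : {A B : Set} (dA : Dec A) (dB : Dec B) → (A → B) → (B → A) → ind dA ≡ ind dB
ind-iff dA dB f g = cong (λ x → if x then 1 else 0) (⌊⌋-iff dA dB f g)

χ-iff : {A B : Set} (dA : Dec A) (dB : Dec B) → (A → B) → (B → A) → χ dA ≡ χ dB
χ-iff dA dB f g = cong (λ x → if x then 1ℤ else 0ℤ) (⌊⌋-iff dA dB f g)

χ-no : {A : Set} (d : Dec A) → ¬ A → χ d ≡ 0ℤ
χ-no (yes a) ¬a = contradiction a ¬a
χ-no (no _) _ = refl

χ≡ind : {A : Set} (d : Dec A) → χ d ≡ + ind d
χ≡ind (yes _) = refl
χ≡ind (no _) = refl

module _ {P : ℕ → Set} (P? : ∀ i → Dec (P i)) where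

  count-none : ∀ s → (∀ i → i ≤ s → ¬ P i) → sumℕ (λ i → ind (P? i)) s ≡ 0
  count-none s none = sumℕ-vanish s (λ i i≤s → ind-no (P? i) (none i i≤s))

  count-unique : ∀ {s w} → w ≤ s → P w → (∀ i → i ≤ s → P i → i ≡ w) → sumℕ (λ i → ind (P? i)) s ≡ 1
  count-unique {zero} z≤n pw _ = ind-yes (P? 0) pw
  count-unique {suc s} {w} w≤s pw unique with w ≟ suc s
  ... | yes refl = cong₂ _+_ (count-none s (λ i i≤s pi → <-irrefl (unique i (m≤n⇒m≤1+n i≤s) pi) (s≤s i≤s)))
                             (ind-yes (P? (suc s)) pw)
  ... | no w≢ = cong₂ _+_ (count-unique (≤-pred (≤∧≢⇒< w≤s w≢)) pw (λ i i≤s → unique i (m≤n⇒m≤1+n i≤s)))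
                          (ind-no (P? (suc s)) (λ p → w≢ (sym (unique (suc s) ≤-refl p))))

sumℤ-drop : ∀ {F} e m → (∀ i → i < e → F i ≡ 0ℤ) → sumℤ F (e + m) ≡ sumℤ (λ j → F (e + j)) m
sumℤ-drop zero m _ = refl
sumℤ-drop {F} (suc e) zero vanish = begin
  sumℤ F (suc e + 0)          ≡⟨ cong (sumℤ F) (+-identityʳ (suc e)) ⟩
  sumℤ F e ℤ.+ F (suc e)      ≡⟨ cong (ℤ._+ F (suc e)) (sumℤ-vanish e (λ i i≤e → vanish i (s≤s i≤e))) ⟩
  0ℤ ℤ.+ F (suc e)            ≡⟨ ℤ.+-identityˡ (F (suc e)) ⟩
  F (suc e)                   ≡⟨ cong F (sym (+-identityʳ (suc e))) ⟩
  F (suc e + 0)               ∎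
  where open ≡-Reasoning
sumℤ-drop {F} (suc e) (suc m) vanish rewrite +-suc e m =
  cong (ℤ._+ F (suc (suc (e + m)))) (sumℤ-drop (suc e) m vanish)

sumℤ-sub : ∀ f g n → sumℤ (λ i → f i ℤ.- g i) n ≡ sumℤ f n ℤ.- sumℤ g n
sumℤ-sub f g zero = refl
sumℤ-sub f g (suc n) rewrite sumℤ-sub f g n = regroup (sumℤ f n) (sumℤ g n) (f (suc n)) (g (suc n))
  where
  regroup : ∀ x y u v → x ℤ.- y ℤ.+ (u ℤ.- v) ≡ x ℤ.+ u ℤ.- (y ℤ.+ v)
  regroup = solve-∀

sub-to-add : ∀ {x y z} → x ℤ.- y ≡ z → x ≡ z ℤ.+ y
sub-to-add {x} {y} eq = trans (sym (cancel x y)) (cong (ℤ._+ y) eq)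
  where
  cancel : ∀ x y → x ℤ.- y ℤ.+ y ≡ x
  cancel = solve-∀

-- shift e f is the series z^e·f: its coefficients are those of f, delayed by e.
shift : ℕ → FPS → FPS
shift zero    f n       = f n
shift (suc e) f zero    = 0ℤ
shift (suc e) f (suc n) = shift e f n

shift-cancel : ∀ e c f m → shift (e + c) f (e + m) ≡ shift c f m
shift-cancel zero    c f m = refl
shift-cancel (suc e) c f m = shift-cancel e c f m

shift-from : ∀ e f m → shift e f (e + m) ≡ f m
shift-from zero    f m = refl
shift-from (suc e) f m = shift-from e f m

shift-below : ∀ {e n} f → n < e → shift e f n ≡ 0ℤ
shift-below {suc e} {zero}  f _         = refl
shift-below {suc e} {suc n} f (s≤s n<e) = shift-below f n<e

shift-cong : ∀ e {f g} → f ≈ₛ g → shift e f ≈ₛ shift e g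
shift-cong zero    f≈g n       = f≈g n
shift-cong (suc e) f≈g zero    = refl
shift-cong (suc e) f≈g (suc n) = shift-cong e f≈g n

shift-⊖ : ∀ e f g → shift e (f ⊖ g) ≈ₛ shift e f ⊖ shift e g
shift-⊖ zero    f g n       = refl
shift-⊖ (suc e) f g zero    = refl
shift-⊖ (suc e) f g (suc n) = shift-⊖ e f g n

data Position (e : ℕ) : ℕ → Set where
  below : ∀ {n} → n < e → Position e n
  above : ∀ m → Position e (e + m)

position : ∀ e n → Position e n
position zero    n    = above n
position (suc e) zero = below (s≤s z≤n)
position (suc e) (suc n) with position e n
... | below n<e = below (s≤s n<e)
... | above m   = above m

⊛-congˡ : ∀ {f f'} g → f ≈ₛ f' → f ⊛ g ≈ₛ f' ⊛ g
⊛-congˡ g f≈f' n = sumℤ-cong n (λ i _ → cong (ℤ._* g (n ∸ i)) (f≈f' i))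

⊖-⊛ : ∀ f g h → (f ⊖ g) ⊛ h ≈ₛ f ⊛ h ⊖ g ⊛ h
⊖-⊛ f g h n = trans (sumℤ-cong n (λ i _ → distrib (f i) (g i) (h (n ∸ i))))
                    (sumℤ-sub (λ i → f i ℤ.* h (n ∸ i)) (λ i → g i ℤ.* h (n ∸ i)) n)
  where
  distrib : ∀ x y z → (x ℤ.- y) ℤ.* z ≡ x ℤ.* z ℤ.- y ℤ.* z
  distrib = solve-∀

shift-⊛ : ∀ e f g → shift e f ⊛ g ≈ₛ shift e (f ⊛ g)
shift-⊛ e f g n with position e n
... | below n<e =
  trans (sumℤ-vanish n (λ i i≤n → cong (ℤ._* g (n ∸ i)) (shift-below f (≤-<-trans i≤n n<e))))
        (sym (shift-below (f ⊛ g) n<e))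
... | above m = begin
  sumℤ (λ i → shift e f i ℤ.* g (e + m ∸ i)) (e + m)
    ≡⟨ sumℤ-drop e m (λ i i<e → cong (ℤ._* g (e + m ∸ i)) (shift-below f i<e)) ⟩
  sumℤ (λ j → shift e f (e + j) ℤ.* g (e + m ∸ (e + j))) m
    ≡⟨ sumℤ-cong m (λ j _ → cong₂ ℤ._*_ (shift-from e f j) (cong g ([m+n]∸[m+o]≡n∸o e m j))) ⟩
  (f ⊛ g) m
    ≡⟨ sym (shift-from e (f ⊛ g) m) ⟩
  shift e (f ⊛ g) (e + m) ∎
  where open ≡-Reasoning

-- 1 is a left unit: only the summand i = 0 of (one ⊛ f) n survives.
one-⊛ : ∀ f → one ⊛ f ≈ₛ f
one-⊛ f n = trans (sumℤ-truncate {f = λ i → one i ℤ.* f (n ∸ i)} {M = n} z≤n (λ { (suc i) _ → refl }))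
                  (ℤ.*-identityˡ (f n))

shift-mono : ∀ c d → shift c (mono d) ≈ₛ mono (c + d)
shift-mono c d n with position c n
... | below n<c = trans (shift-below (mono d) n<c)
                        (sym (χ-no (n ≟ c + d) (λ { refl → <⇒≱ n<c (m≤m+n c d) })))
... | above m = trans (shift-from c (mono d) m)
                      (χ-iff (m ≟ d) (c + m ≟ c + d) (cong (c ℕ.+_)) (+-cancelˡ-≡ c m d))

shift-one : ∀ c → shift c one ≈ₛ mono c
shift-one c n = trans (shift-mono c 0 n) (cong (λ e → mono e n) (+-identityʳ c))

mono-⊛ : ∀ e f → mono e ⊛ f ≈ₛ shift e f
mono-⊛ e f n = begin
  (mono e ⊛ f) n      ≡⟨ ⊛-congˡ f (λ i → sym (shift-one e i)) n ⟩
  (shift e one ⊛ f) n ≡⟨ shift-⊛ e one f n ⟩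
  shift e (one ⊛ f) n ≡⟨ shift-cong e (one-⊛ f) n ⟩
  shift e f n         ∎
  where open ≡-Reasoning

mono-tail : ∀ c f g → (mono c ⊛ f) ⊛ g ≈ₛ shift c (f ⊛ g)
mono-tail c f g n = trans (⊛-congˡ g (mono-⊛ c f) n) (shift-⊛ c f g n)

mono-assoc : ∀ c f g → mono c ⊛ (f ⊛ g) ≈ₛ (mono c ⊛ f) ⊛ g
mono-assoc c f g n = trans (mono-⊛ c (f ⊛ g) n) (sym (mono-tail c f g n))

mono-binomial : ∀ c d → mono c ⊛ (one ⊖ mono d) ≈ₛ mono c ⊖ mono (c + d)
mono-binomial c d n = begin
  (mono c ⊛ (one ⊖ mono d)) n          ≡⟨ mono-⊛ c (one ⊖ mono d) n ⟩
  shift c (one ⊖ mono d) n             ≡⟨ shift-⊖ c one (mono d) n ⟩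
  shift c one n ℤ.- shift c (mono d) n ≡⟨ cong₂ ℤ._-_ (shift-one c n) (shift-mono c d n) ⟩
  mono c n ℤ.- mono (c + d) n          ∎
  where open ≡-Reasoning

⊖-⊛⊛ : ∀ {x y z} f g → x ≈ₛ y ⊖ z → x ⊛ f ⊛ g ≈ₛ y ⊛ f ⊛ g ⊖ z ⊛ f ⊛ g
⊖-⊛⊛ {x} {y} {z} f g x≈y-z n = begin
  (x ⊛ f ⊛ g) n                   ≡⟨ ⊛-congˡ g (⊛-congˡ f x≈y-z) n ⟩
  ((y ⊖ z) ⊛ f ⊛ g) n             ≡⟨ ⊛-congˡ g (⊖-⊛ y z f) n ⟩
  ((y ⊛ f ⊖ z ⊛ f) ⊛ g) n         ≡⟨ ⊖-⊛ (y ⊛ f) (z ⊛ f) g n ⟩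
  (y ⊛ f ⊛ g ⊖ z ⊛ f ⊛ g) n       ∎
  where open ≡-Reasoning

binomial-coefficients : ∀ c d f g →
  mono c ⊛ (one ⊖ mono d) ⊛ f ⊛ g ≈ₛ shift c (f ⊛ g) ⊖ shift (c + d) (f ⊛ g)
binomial-coefficients c d f g n =
  trans (⊖-⊛⊛ {mono c ⊛ (one ⊖ mono d)} {mono c} {mono (c + d)} f g (mono-binomial c d) n)
        (cong₂ ℤ._-_ (mono-tail c f g n) (mono-tail (c + d) f g n))

squared-binomial : ∀ c d f g →
  mono c ⊛ ((one ⊖ mono d) ⊛ (one ⊖ mono d)) ⊛ f ⊛ g
    ≈ₛ mono c ⊛ (one ⊖ mono d) ⊛ f ⊛ g ⊖ mono (c + d) ⊛ (one ⊖ mono d) ⊛ f ⊛ g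
squared-binomial c d f g = ⊖-⊛⊛ {mono c ⊛ (P ⊛ P)} {mono c ⊛ P} {mono (c + d) ⊛ P} f g (λ n → begin
  (mono c ⊛ (P ⊛ P)) n                     ≡⟨ mono-assoc c P P n ⟩
  ((mono c ⊛ P) ⊛ P) n                     ≡⟨ ⊛-congˡ P (mono-binomial c d) n ⟩
  ((mono c ⊖ mono (c + d)) ⊛ P) n          ≡⟨ ⊖-⊛ (mono c) (mono (c + d)) P n ⟩
  (mono c ⊛ P ⊖ mono (c + d) ⊛ P) n        ∎)
  where
  open ≡-Reasoning
  P : FPS
  P = one ⊖ mono d

module LevelSets (ρ : ℕ → ℕ) (N : ℕ)
                 (ρ-period : ∀ n → ρ (N + n) ≡ suc (ρ n))
                 (ρ-small : ∀ n → n < N → ρ n ≤ 1) where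

  R : FPS
  R n = + ρ n

  exceeds : ∀ k n → χ (k <? ρ n) ≡ shift (k * N) R n ℤ.- shift (k * N + N) R n
  exceeds zero n with position N n
  ... | below n<N = trans (initial (ρ n) (ρ-small n n<N)) (cong (λ y → R n ℤ.- y) (sym (shift-below R n<N)))
    where
    initial : ∀ x → x ≤ 1 → χ (0 <? x) ≡ + x ℤ.- 0ℤ
    initial zero          _ = refl
    initial (suc zero)    _ = refl
    initial (suc (suc x)) (s≤s ())
  ... | above m = begin
    χ (0 <? ρ (N + m))              ≡⟨ cong (λ x → χ (0 <? x)) (ρ-period m) ⟩
    1ℤ                              ≡⟨ sym (increment (R m)) ⟩
    1ℤ ℤ.+ R m ℤ.- R m              ≡⟨ cong₂ ℤ._-_ (cong +_ (sym (ρ-period m))) (sym (shift-from N R m)) ⟩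
    R (N + m) ℤ.- shift N R (N + m) ∎
    where
    open ≡-Reasoning
    increment : ∀ y → 1ℤ ℤ.+ y ℤ.- y ≡ 1ℤ
    increment = solve-∀
  exceeds (suc k) n with position N n
  ... | below n<N = trans (χ-no (suc k <? ρ n) (λ k<ρ → <⇒≱ k<ρ (≤-trans (ρ-small n n<N) (s≤s z≤n))))
                          (sym (cong₂ ℤ._-_ (shift-below R (<-≤-trans n<N N≤c)) (shift-below R (<-≤-trans n<N N≤c+N))))
    where
    N≤c : N ≤ N + k * N
    N≤c = m≤m+n N (k * N)
    N≤c+N : N ≤ N + k * N + N
    N≤c+N = ≤-trans N≤c (m≤m+n (N + k * N) N)
  ... | above m = begin
    χ (suc k <? ρ (N + m))                                       ≡⟨ cong (λ x → χ (suc k <? x)) (ρ-period m) ⟩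
    χ (suc k <? suc (ρ m))                                       ≡⟨ χ-iff (suc k <? suc (ρ m)) (k <? ρ m) ≤-pred s≤s ⟩
    χ (k <? ρ m)                                                 ≡⟨ exceeds k m ⟩
    shift (k * N) R m ℤ.- shift (k * N + N) R m                  ≡⟨ cong₂ ℤ._-_ (sym (shift-cancel N (k * N) R m))
                                                                                 (sym (shift-cancel N (k * N + N) R m)) ⟩
    shift (N + k * N) R (N + m) ℤ.- shift (N + (k * N + N)) R (N + m)
                                                                 ≡⟨ cong (λ e → shift (N + k * N) R (N + m) ℤ.- shift e R (N + m))
                                                                         (sym (+-assoc N (k * N) N)) ⟩
    shift (N + k * N) R (N + m) ℤ.- shift (N + k * N + N) R (N + m) ∎
    where open ≡-Reasoning

exactly-succ : ∀ k x → χ (x ≟ suc k) ≡ χ (k <? x) ℤ.- χ (suc k <? x)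
exactly-succ k x with x ≟ suc k | k <? x | suc k <? x
... | yes refl | yes _   | yes k+1<x = contradiction k+1<x (<-irrefl refl)
... | yes refl | yes _   | no _      = refl
... | yes refl | no k≮x  | _         = contradiction ≤-refl k≮x
... | no _     | yes _   | yes _     = refl
... | no x≢    | yes k<x | no k+1≮x  = contradiction (≤-antisym (≮⇒≥ k+1≮x) k<x) x≢
... | no _     | no _    | no _      = refl
... | no _     | no k≮x  | yes k+1<x = contradiction (<-trans (n<1+n k) k+1<x) k≮x

module Residues {m' n : ℕ} (coprime : Coprime (suc m') n) where

  private
    m : ℕ
    m = suc m'

  -- Bézout: n is invertible modulo m, so some r + t·n is a multiple of m.
  completion-exists : ∀ r → ∃ λ t → m ∣ r + t * n
  completion-exists r with coprime-Bézout coprime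
  ... | Bézout.+- x y eq = r * y , subst (m ∣_) (sym bezout) (∣n⇒∣m*n r (n∣m*n x))
    where
    factor : ∀ r y n → r + r * y * n ≡ r * (1 + y * n)
    factor = ℕ-solve-∀
    bezout : r + r * y * n ≡ r * (x * m)
    bezout = trans (factor r y n) (cong (r *_) eq)
  ... | Bézout.-+ x y eq = r * m' * y , subst (m ∣_) (sym bezout) (n∣m*n (r + r * m' * x))
    where
    reassociate : ∀ r m' y n → r + r * m' * y * n ≡ r + r * m' * (y * n)
    reassociate = ℕ-solve-∀
    factor : ∀ r m' x → r + r * m' * (1 + x * suc m') ≡ (r + r * m' * x) * suc m'
    factor = ℕ-solve-∀
    bezout : r + r * m' * y * n ≡ (r + r * m' * x) * m
    bezout = trans (reassociate r m' y n) (trans (cong (λ z → r + r * m' * z) (sym eq)) (factor r m' x))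

  -- Reducing t modulo m keeps r + t·n a multiple of m.
  residue-exists : ∀ r → ∃ λ t → t ≤ m' × m ∣ r + t * n
  residue-exists r with completion-exists r
  ... | t , m∣ = t % m , ≤-pred (m%n<n t m) , ∣m+n∣m⇒∣n (subst (m ∣_) reduce m∣) (m∣m*n (t / m * n))
    where
    expand : ∀ r u q m n → r + (u + q * m) * n ≡ m * (q * n) + (r + u * n)
    expand = ℕ-solve-∀
    reduce : r + t * n ≡ m * (t / m * n) + (r + t % m * n)
    reduce = trans (cong (λ z → r + z * n) (m≡m%n+[m/n]*n t m)) (expand r (t % m) (t / m) m n)

  -- Two distinct admissible t, u would give m ∣ (u - t)·n, hence m ∣ u - t < m.
  no-two-residues : ∀ r {t u} → t < u → u ≤ m' → m ∣ r + t * n → m ∣ r + u * n → ⊥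
  no-two-residues r {t} {u} t<u u≤m' m∣t m∣u =
    <⇒≱ (s≤s (≤-trans (m∸n≤m u t) u≤m')) (∣⇒≤ ⦃ >-nonZero (m<n⇒0<n∸m t<u) ⦄ m∣u∸t)
    where
    split : r + u * n ≡ (r + t * n) + n * (u ∸ t)
    split = trans (cong (λ z → r + z * n) (sym (m+[n∸m]≡n (<⇒≤ t<u)))) (expand r t (u ∸ t) n)
      where
      expand : ∀ r t d n → r + (t + d) * n ≡ (r + t * n) + n * d
      expand = ℕ-solve-∀
    m∣u∸t : m ∣ u ∸ t
    m∣u∸t = coprime-divisor coprime (∣m+n∣m⇒∣n (subst (m ∣_) split m∣u) m∣t)

  residue-unique : ∀ r {t u} → t ≤ m' → u ≤ m' → m ∣ r + t * n → m ∣ r + u * n → t ≡ u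
  residue-unique r {t} {u} t≤m' u≤m' m∣t m∣u with <-cmp t u
  ... | tri≈ _ t≡u _ = t≡u
  ... | tri< t<u _ _ = ⊥-elim (no-two-residues r t<u u≤m' m∣t m∣u)
  ... | tri> _ _ u<t = ⊥-elim (no-two-residues r u<t t≤m' m∣u m∣t)

small-multiple : ∀ {d n} → n < d → d ∣ n → n ≡ 0
small-multiple {n = zero}  _   _   = refl
small-multiple {n = suc n} n<d d∣n = contradiction (∣⇒≤ d∣n) (<⇒≱ n<d)

module Representations (a' b' : ℕ) (coprime : Coprime (suc a') (suc b')) where

  a b N : ℕ
  a = suc a'
  b = suc b'
  N = a * b

  r : ℕ → ℕ
  r = reps a b

  repsWithin : ℕ → ℕ → ℕ → ℕ
  repsWithin M Q j = sumℕ (λ m → sumℕ (λ q → ind (m * a + q * b ≟ j)) Q) M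

  -- Any bounds M, Q ≥ j capture all solutions, since m ≤ m·a ≤ j and q ≤ q·b ≤ j.
  reps-bounds : ∀ {M Q j} → j ≤ M → j ≤ Q → repsWithin M Q j ≡ r j
  reps-bounds {M} {Q} {j} j≤M j≤Q = trans (sumℕ-cong M (λ m _ → sumℕ-truncate j≤Q (q-large m)))
                                         (sumℕ-truncate j≤M m-large)
    where
    q-large : ∀ m q → j < q → ind (m * a + q * b ≟ j) ≡ 0
    q-large m q j<q = ind-no (m * a + q * b ≟ j)
      (λ e → <⇒≱ j<q (≤-trans (m≤m*n q b) (≤-trans (m≤n+m (q * b) (m * a)) (≤-reflexive e))))
    m-large : ∀ m → j < m → sumℕ (λ q → ind (m * a + q * b ≟ j)) j ≡ 0
    m-large m j<m = count-none (λ q → m * a + q * b ≟ j) j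
      (λ q _ e → <⇒≱ j<m (≤-trans (m≤m*n m a) (≤-trans (m≤m+n (m * a) (q * b)) (≤-reflexive e))))

  multiples : ∀ {Q j} → j ≤ Q → sumℕ (λ q → ind (q * b ≟ j)) Q ≡ ind (b ∣? j)
  multiples {Q} {j} j≤Q with b ∣? j
  ... | yes (divides q j≡qb) =
    count-unique (λ i → i * b ≟ j) (≤-trans (≤-trans (m≤m*n q b) (≤-reflexive (sym j≡qb))) j≤Q) (sym j≡qb)
                 (λ i _ ib≡j → *-cancelʳ-≡ i q b (trans ib≡j j≡qb))
  ... | no b∤j = count-none (λ i → i * b ≟ j) Q (λ i _ ib≡j → b∤j (divides i (sym ib≡j)))

  reps-peel : ∀ {M j} → j ≤ M →
              r j ≡ ind (b ∣? j) + sumℕ (λ m → sumℕ (λ q → ind (suc m * a + q * b ≟ j)) M) M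
  reps-peel {M} {j} j≤M = begin
    r j                                    ≡⟨ sym (reps-bounds {suc M} {M} (m≤n⇒m≤1+n j≤M) j≤M) ⟩
    repsWithin (suc M) M j                 ≡⟨ sumℕ-split (λ m → inner m) 0 M ⟩
    inner 0 + sumℕ (λ m → inner (suc m)) M ≡⟨ cong (_+ sumℕ (λ m → inner (suc m)) M) (multiples j≤M) ⟩
    ind (b ∣? j) + sumℕ (λ m → inner (suc m)) M ∎
    where
    open ≡-Reasoning
    inner : ℕ → ℕ
    inner m = sumℕ (λ q → ind (m * a + q * b ≟ j)) M

  -- Below a only m = 0 is possible.
  reps-below : ∀ {j} → j < a → r j ≡ ind (b ∣? j)
  reps-below {j} j<a = begin
    r j
      ≡⟨ reps-peel {j} ≤-refl ⟩
    ind (b ∣? j) + sumℕ (λ m → sumℕ (λ q → ind (suc m * a + q * b ≟ j)) j) j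
      ≡⟨ cong (ind (b ∣? j) ℕ.+_) (sumℕ-vanish j none) ⟩
    ind (b ∣? j) + 0
      ≡⟨ +-identityʳ _ ⟩
    ind (b ∣? j) ∎
    where
    open ≡-Reasoning
    none : ∀ m → m ≤ j → sumℕ (λ q → ind (suc m * a + q * b ≟ j)) j ≡ 0
    none m _ = count-none (λ q → suc m * a + q * b ≟ j) j
      (λ q _ e → <⇒≱ j<a (≤-trans (m≤m+n a (m * a + q * b)) (≤-reflexive (trans (sym (+-assoc a _ _)) e))))

  reps-step : ∀ n → r (a + n) ≡ ind (b ∣? (a + n)) + r n
  reps-step n = begin
    r (a + n)                                              ≡⟨ reps-peel {a + n} ≤-refl ⟩
    ind (b ∣? (a + n)) + sumℕ (λ m → sumℕ (shifted m) M) M ≡⟨ cong (ind (b ∣? (a + n)) ℕ.+_) unshifted ⟩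
    ind (b ∣? (a + n)) + repsWithin M M n                  ≡⟨ cong (ind (b ∣? (a + n)) ℕ.+_) (reps-bounds n≤M n≤M) ⟩
    ind (b ∣? (a + n)) + r n                               ∎
    where
    open ≡-Reasoning
    M : ℕ
    M = a + n
    shifted : ℕ → ℕ → ℕ
    shifted m q = ind (suc m * a + q * b ≟ a + n)
    n≤M : n ≤ M
    n≤M = m≤n+m n a
    unshift : ∀ m q → shifted m q ≡ ind (m * a + q * b ≟ n)
    unshift m q = ind-iff (suc m * a + q * b ≟ a + n) (m * a + q * b ≟ n)
      (λ e → +-cancelˡ-≡ a _ _ (trans (sym (+-assoc a _ _)) e))
      (λ e → trans (+-assoc a _ _) (cong (a ℕ.+_) e))
    unshifted : sumℕ (λ m → sumℕ (shifted m) M) M ≡ repsWithin M M n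
    unshifted = sumℕ-cong M (λ m _ → sumℕ-cong M (λ q _ → unshift m q))

  -- Writing j = ρ + s·a with ρ < a, the solutions are indexed by t = s - m ≤ s with b ∣ ρ + t·a.
  hits : ℕ → ℕ → ℕ
  hits ρ s = sumℕ (λ t → ind (b ∣? ρ + t * a)) s

  reps-hits : ∀ {ρ} → ρ < a → ∀ s → r (ρ + s * a) ≡ hits ρ s
  reps-hits {ρ} ρ<a zero = reps-below (subst (_< a) (sym (+-identityʳ ρ)) ρ<a)
  reps-hits {ρ} ρ<a (suc s) = begin
    r (ρ + (a + s * a))                             ≡⟨ cong r (swap ρ a (s * a)) ⟩
    r (a + (ρ + s * a))                             ≡⟨ reps-step (ρ + s * a) ⟩
    ind (b ∣? (a + (ρ + s * a))) + r (ρ + s * a)    ≡⟨ cong₂ _+_ (cong (λ x → ind (b ∣? x)) (sym (swap ρ a (s * a))))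
                                                              (reps-hits ρ<a s) ⟩
    ind (b ∣? (ρ + (a + s * a))) + hits ρ s         ≡⟨ +-comm _ (hits ρ s) ⟩
    hits ρ (suc s)                                  ∎
    where
    open ≡-Reasoning
    swap : ∀ x y z → x + (y + z) ≡ y + (x + z)
    swap = ℕ-solve-∀

  open Residues (Coprimality.sym coprime) using (residue-exists; residue-unique)

  -- Coprimality: among any b consecutive t = 0, …, b' exactly one has b ∣ ρ + t·a.
  hits-block : ∀ ρ → hits ρ b' ≡ 1
  hits-block ρ with residue-exists ρ
  ... | t , t≤b' , b∣ = count-unique (λ i → b ∣? ρ + i * a) t≤b' b∣
                          (λ i i≤b' b∣i → residue-unique ρ i≤b' t≤b' b∣i b∣)

  hits-period : ∀ ρ s → hits ρ (b' + suc s) ≡ suc (hits ρ s)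
  hits-period ρ s = begin
    hits ρ (b' + suc s)                                        ≡⟨ sumℕ-split (λ t → ind (b ∣? ρ + t * a)) b' s ⟩
    hits ρ b' + sumℕ (λ t → ind (b ∣? ρ + (b + t) * a)) s      ≡⟨ cong₂ _+_ (hits-block ρ) (sumℕ-cong s periodic) ⟩
    suc (hits ρ s)                                             ∎
    where
    open ≡-Reasoning
    expand : ∀ ρ b t a → ρ + (b + t) * a ≡ b * a + (ρ + t * a)
    expand = ℕ-solve-∀
    regroup : ∀ t → ρ + (b + t) * a ≡ b * a + (ρ + t * a)
    regroup t = expand ρ b t a
    periodic : ∀ t → t ≤ s → ind (b ∣? ρ + (b + t) * a) ≡ ind (b ∣? ρ + t * a)
    periodic t _ = ind-iff (b ∣? ρ + (b + t) * a) (b ∣? ρ + t * a)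
      (λ d → ∣m+n∣m⇒∣n (subst (b ∣_) (regroup t) d) (m∣m*n a))
      (λ d → subst (b ∣_) (sym (regroup t)) (∣m∣n⇒∣m+n (m∣m*n a) d))

  hits-small : ∀ ρ {s} → s ≤ b' → hits ρ s ≤ 1
  hits-small ρ {s} s≤b' = subst (hits ρ s ≤_) (hits-block ρ) (sumℕ-mono (λ t → ind (b ∣? ρ + t * a)) s≤b')

  reps-residue : ∀ n → r n ≡ hits (n % a) (n / a)
  reps-residue n = trans (cong r (m≡m%n+[m/n]*n n a)) (reps-hits (m%n<n n a) (n / a))

  reps-period : ∀ n → r (N + n) ≡ suc (r n)
  reps-period n = begin
    r (N + n)                               ≡⟨ cong (λ x → r (N + x)) (m≡m%n+[m/n]*n n a) ⟩
    r (N + (n % a + n / a * a))             ≡⟨ cong r (regroup a' b' (n % a) (n / a)) ⟩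
    r (n % a + (b' + suc (n / a)) * a)      ≡⟨ reps-hits (m%n<n n a) (b' + suc (n / a)) ⟩
    hits (n % a) (b' + suc (n / a))         ≡⟨ hits-period (n % a) (n / a) ⟩
    suc (hits (n % a) (n / a))              ≡⟨ cong suc (sym (reps-residue n)) ⟩
    suc (r n)                               ∎
    where
    open ≡-Reasoning
    regroup : ∀ a' b' ρ s → suc a' * suc b' + (ρ + s * suc a') ≡ ρ + (b' + suc s) * suc a'
    regroup = ℕ-solve-∀

  reps-small : ∀ n → n < N → r n ≤ 1
  reps-small n n<N = subst (_≤ 1) (sym (reps-residue n))
                       (hits-small (n % a) (≤-pred (m<n*o⇒m/o<n (subst (n <_) (*-comm a b) n<N))))

  G : FPS
  G = geom a ⊛ geom b

  geom-telescope : ∀ n → geom a n ℤ.- shift a (geom a) n ≡ one n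
  geom-telescope n with position a n
  ... | below n<a = begin
    geom a n ℤ.- shift a (geom a) n ≡⟨ cong (λ y → geom a n ℤ.- y) (shift-below (geom a) n<a) ⟩
    geom a n ℤ.+ 0ℤ                 ≡⟨ ℤ.+-identityʳ (geom a n) ⟩
    χ (a ∣? n)                      ≡⟨ χ-iff (a ∣? n) (n ≟ 0) (small-multiple n<a) (λ { refl → a ∣0 }) ⟩
    one n                           ∎
    where open ≡-Reasoning
  ... | above m = begin
    geom a (a + m) ℤ.- shift a (geom a) (a + m) ≡⟨ cong₂ ℤ._-_ (χ-iff (a ∣? a + m) (a ∣? m) drop-a add-a)
                                                                 (shift-from a (geom a) m) ⟩
    geom a m ℤ.- geom a m                       ≡⟨ ℤ.+-inverseʳ (geom a m) ⟩
    0ℤ                                          ∎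
    where
    open ≡-Reasoning
    drop-a : a ∣ a + m → a ∣ m
    drop-a d = ∣m+n∣m⇒∣n d ∣-refl
    add-a : a ∣ m → a ∣ a + m
    add-a = ∣m∣n⇒∣m+n ∣-refl

  conv-telescope : ∀ n → G n ℤ.- shift a G n ≡ geom b n
  conv-telescope n = begin
    G n ℤ.- shift a G n                                ≡⟨ cong (λ y → G n ℤ.- y) (sym (shift-⊛ a (geom a) (geom b) n)) ⟩
    G n ℤ.- (shift a (geom a) ⊛ geom b) n              ≡⟨ sym (⊖-⊛ (geom a) (shift a (geom a)) (geom b) n) ⟩
    ((geom a ⊖ shift a (geom a)) ⊛ geom b) n           ≡⟨ ⊛-congˡ (geom b) geom-telescope n ⟩
    (one ⊛ geom b) n                                   ≡⟨ one-⊛ (geom b) n ⟩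
    geom b n                                           ∎
    where open ≡-Reasoning

  -- G and r obey the same recursion (base case below a, step by a), so they agree.
  conv≡reps : ∀ n → G n ≡ + r n
  conv≡reps = <-rec (λ n → G n ≡ + r n) agree
    where
    agree : ∀ n → (∀ {m} → m < n → G m ≡ + r m) → G n ≡ + r n
    agree n rec with position a n
    ... | below n<a = begin
      G n                       ≡⟨ sub-to-add (conv-telescope n) ⟩
      geom b n ℤ.+ shift a G n  ≡⟨ cong (λ y → geom b n ℤ.+ y) (shift-below G n<a) ⟩
      geom b n ℤ.+ 0ℤ           ≡⟨ ℤ.+-identityʳ (geom b n) ⟩
      χ (b ∣? n)                ≡⟨ χ≡ind (b ∣? n) ⟩
      + ind (b ∣? n)            ≡⟨ cong +_ (sym (reps-below n<a)) ⟩
      + r n                     ∎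
      where open ≡-Reasoning
    ... | above m = begin
      G (a + m)                             ≡⟨ sub-to-add (conv-telescope (a + m)) ⟩
      geom b (a + m) ℤ.+ shift a G (a + m)  ≡⟨ cong₂ ℤ._+_ (χ≡ind (b ∣? (a + m))) (shift-from a G m) ⟩
      + ind (b ∣? (a + m)) ℤ.+ G m          ≡⟨ cong (λ y → + ind (b ∣? (a + m)) ℤ.+ y) (rec (m<n+m m (s≤s z≤n))) ⟩
      + (ind (b ∣? (a + m)) + r m)          ≡⟨ cong +_ (sym (reps-step m)) ⟩
      + r (a + m)                           ∎
      where open ≡-Reasoning

  open LevelSets r N reps-period reps-small using (exceeds)

  S-formula : ∀ k → Sseries a b k ≈ₛ mono (N * k) ⊛ (one ⊖ mono N) ⊛ geom a ⊛ geom b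
  S-formula k n = begin
    χ (k <? r n)                                      ≡⟨ exceeds k n ⟩
    shift (k * N) R n ℤ.- shift (k * N + N) R n       ≡⟨ cong (λ c → shift c R n ℤ.- shift (c + N) R n) (*-comm k N) ⟩
    shift (N * k) R n ℤ.- shift (N * k + N) R n       ≡⟨ cong₂ ℤ._-_ (shift-cong (N * k) conv≡reps n)
                                                                    (shift-cong (N * k + N) conv≡reps n) ⟨
    shift (N * k) G n ℤ.- shift (N * k + N) G n       ≡⟨ binomial-coefficients (N * k) N (geom a) (geom b) n ⟨
    (mono (N * k) ⊛ (one ⊖ mono N) ⊛ geom a ⊛ geom b) n ∎
    where
    open ≡-Reasoning
    R : FPS
    R j = + r j

  -- Σ_{j ∈ R_k} z^j = z^{N(k-1)} (1 - z^N)^2 G, since R_k = S_{k-1} \ S_k.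
  R-formula : ∀ k → 1 ≤ k →
    Rseries a b k ≈ₛ mono (N * (k ∸ 1)) ⊛ ((one ⊖ mono N) ⊛ (one ⊖ mono N)) ⊛ geom a ⊛ geom b
  R-formula (suc k) _ n = begin
    χ (r n ≟ suc k)                                  ≡⟨ exactly-succ k (r n) ⟩
    Sseries a b k n ℤ.- Sseries a b (suc k) n        ≡⟨ cong₂ ℤ._-_ (S-formula k n) (S-formula (suc k) n) ⟩
    (S (N * k) ⊖ S (N * suc k)) n                    ≡⟨ cong (λ c → (S (N * k) ⊖ S c) n) N[k+1]≡Nk+N ⟩
    (S (N * k) ⊖ S (N * k + N)) n                    ≡⟨ squared-binomial (N * k) N (geom a) (geom b) n ⟨
    (mono (N * k) ⊛ ((one ⊖ mono N) ⊛ (one ⊖ mono N)) ⊛ geom a ⊛ geom b) n ∎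
    where
    open ≡-Reasoning
    S : ℕ → FPS
    S c = mono c ⊛ (one ⊖ mono N) ⊛ geom a ⊛ geom b
    N[k+1]≡Nk+N : N * suc k ≡ N * k + N
    N[k+1]≡Nk+N = trans (*-suc N k) (+-comm N (N * k))

theorem2 : (a b k : ℕ) → 0 < a → 0 < b → Coprime a b →
    (Sseries a b k ≈ₛ mono (a * b * k) ⊛ (one ⊖ mono (a * b)) ⊛ geom a ⊛ geom b)
    × (1 ≤ k →
    Rseries a b k ≈ₛ mono (a * b * (k ∸ 1)) ⊛ ((one ⊖ mono (a * b)) ⊛ (one ⊖ mono (a * b))) ⊛ geom a ⊛ geom b)
theorem2 (suc a') (suc b') k _ _ coprime = S-formula k , R-formula k
  where open Representations a' b' coprime
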